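{- Let $a,b,q$ be indeterminates. For every nonempty partition $\mu$, \[ (1-q^{|\mu|})W_{\mu}(a,b,q)=\sum_{i:\ m_i(\mu)\neq0}(a^i-b^i)\,W_{\mu\setminus\{i\}}(qa,b,q), \] where $W_\emptyset=1$.
   Context: For a partition $\mu$ of length $l$, $C_\mu$ is the set of distinct sequences $c=(c_1,\ldots,c_l)$ obtained by permuting the parts of $\mu$, $[c_i]=c_1+\cdots+c_i$, and $W_{\mu}(a,b,q)=\sum_{c\in C_{\mu}}\prod_{i=1}^{l}\frac{a^{c_i}q^{(l-i)c_i}-b^{c_i}}{1-q^{[c_i]}}$. $m_i(\mu)$ is the multiplicity of $i$ in $\mu$, $|\mu|$ the sum of parts, $\mu\setminus\{i\}$ the partition obtained by removing one part equal to $i$. -}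

module Defs where

open import Data.Nat as ℕ using (ℕ; zero; suc)
open import Data.List using (List; []; _∷_; length; concatMap; map; deduplicate; foldr)
open import Data.List.Properties using (≡-dec)
open import Data.Rational using (ℚ; 0ℚ; 1ℚ; _+_; _*_; _-_; 1/_)
open import Data.Rational.Properties using (_≟_)
open import Relation.Nullary using (yes; no)
open import Data.Rational using (NonZero; ≢-nonZero)

pow : ℚ → ℕ → ℚ
pow x zero    = 1ℚ
pow x (suc n) = x * pow x n

-- total inverse (x⁻¹ for x ≠ 0, junk value 0 at 0; never used at 0 under
-- the hypotheses of the theorem)
inv : ℚ → ℚ
inv x with x ≟ 0ℚ
... | yes _  = 0ℚ
... | no x≢0 = 1/_ x {{≢-nonZero x≢0}}

insertions : ℕ → List ℕ → List (List ℕ)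
insertions x []       = (x ∷ []) ∷ []
insertions x (y ∷ ys) = (x ∷ y ∷ ys) ∷ map (y ∷_) (insertions x ys)

permutations : List ℕ → List (List ℕ)
permutations []       = [] ∷ []
permutations (x ∷ xs) = concatMap (insertions x) (permutations xs)

C : List ℕ → List (List ℕ)
C μ = deduplicate (≡-dec ℕ._≟_) (permutations μ)

-- ∏_{i} (a^{c_i} q^{(l-i) c_i} - b^{c_i}) / (1 - q^{[c_i]}),
-- where s is the partial sum c_1 + ... + c_{i-1}; note l - i = length of the tail
prodW : ℚ → ℚ → ℚ → ℕ → List ℕ → ℚ
prodW a b q s []       = 1ℚ
prodW a b q s (c ∷ cs) =
  ((pow a c * pow q (length cs ℕ.* c) - pow b c) * inv (1ℚ - pow q (s ℕ.+ c)))
  * prodW a b q (s ℕ.+ c) cs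

-- W_μ(a,b,q) (for μ = [] this is the empty product 1, i.e. W_∅ = 1)
W : List ℕ → ℚ → ℚ → ℚ → ℚ
W μ a b q = foldr _+_ 0ℚ (map (prodW a b q 0) (C μ))

removeOne : ℕ → List ℕ → List ℕ
removeOne i []       = []
removeOne i (x ∷ xs) with i ℕ.≟ x
... | yes _ = xs
... | no  _ = x ∷ removeOne i xs

distinctParts : List ℕ → List ℕ
distinctParts = deduplicate ℕ._≟_

sumℚ : List ℚ → ℚ
sumℚ = foldr _+_ 0ℚ

data IsPartition : List ℕ → Set where
  nil  : IsPartition []
  one  : ∀ {x} → 1 ℕ.≤ x → IsPartition (x ∷ [])
  cons : ∀ {x y ys} → y ℕ.≤ x → IsPartition (y ∷ ys) → IsPartition (x ∷ y ∷ ys)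

{-# OPTIONS --safe #-}
-- Every c ∈ C_μ ends in a part i of μ, and c = d ++ [i] for a unique
-- d ∈ C_{μ∖{i}}.  The last factor of the product for c is
-- (a^i - b^i)/(1 - q^{|μ|}), and the remaining factors form the product for d
-- evaluated at (qa, b, q).  Grouping C_μ by the last part therefore gives
-- W_μ(a,b,q) = Σ_i (a^i - b^i) W_{μ∖{i}}(qa,b,q) / (1 - q^{|μ|}).
module Submission where

open import Defs
open import Data.Nat using (ℕ; _≤_; suc)
open import Data.List using (List; []; _∷_; map)
open import Data.Nat.ListAction using (sum)
open import Data.Rational using (ℚ; 1ℚ; _*_; _-_)
open import Relation.Binary.PropositionalEquality using (_≡_; _≢_)

import Data.Nat as ℕ
open import Data.Nat.Properties using (≤-refl; ≤-trans; m≤m+n; +-assoc; +-identityʳ)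
open import Data.Nat.ListAction.Properties using (sum-↭)
open import Data.List
  using (_++_; _∷ʳ_; length; concat; concatMap; initLast; _∷ʳ′_)
open import Data.List.Properties using (≡-dec; map-∘; map-cong-local; map-concatMap; ∷ʳ-injective; ++-identityʳ)
open import Data.Rational using (0ℚ; _+_; 1/_; ≢-nonZero)
import Data.Rational.Properties as ℚ
open import Data.Rational.Solver using (module +-*-Solver)
open import Relation.Binary.Core using (_Preserves_⟶_)
open import Relation.Binary.PropositionalEquality
  using (refl; sym; trans; cong; cong₂; subst; setoid; module ≡-Reasoning)
open import Relation.Nullary using (yes; no)
open import Data.Empty using (⊥; ⊥-elim)
open import Data.Product using (_×_; _,_; proj₁; proj₂)
open import Function using (_∘_)
open import Function.Bundles using (mk⇔; Equivalence)
open import Data.List.Membership.Propositional using (_∈_; find; lose)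
open import Data.List.Membership.Propositional.Properties
  using (∈-++⁺ʳ; ∈-map⁺; ∈-map⁻; ∈-∃++; deduplicate-∈⇔; ∈-concatMap⁺; ∈-concatMap⁻)
open import Data.List.Membership.Propositional.Properties.WithK using (unique∧set⇒bag)
open import Data.List.Relation.Unary.Any using (here; there)
import Data.List.Relation.Unary.All as All
import Data.List.Relation.Unary.All.Properties as All
import Data.List.Relation.Unary.AllPairs as AllPairs
import Data.List.Relation.Unary.AllPairs.Properties as AllPairs
open import Data.List.Relation.Unary.Unique.Propositional using (Unique)
import Data.List.Relation.Unary.Unique.Propositional.Properties as Unique
import Data.List.Relation.Unary.Unique.DecPropositional.Properties as Unique
open import Data.List.Relation.Binary.Permutation.Propositional
  using (_↭_; ↭-refl; ↭-sym; ↭-trans; prep; swap; ↭⇒↭ₛ)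
open import Data.List.Relation.Binary.Permutation.Propositional.Properties
  using (↭-empty-inv; ∈-resp-↭; drop-mid; ∷↭∷ʳ)
  renaming (map⁺ to ↭-map⁺)
open import Data.List.Relation.Binary.Permutation.Setoid.Properties using (foldr-commMonoid)
open import Data.List.Relation.Binary.BagAndSetEquality using (∼bag⇒↭)

open ≡-Reasoning
open +-*-Solver using (solve; _:=_; _:*_; _:-_; con)

sumℚ-↭ : sumℚ Preserves _↭_ ⟶ _≡_
sumℚ-↭ p = foldr-commMonoid (setoid ℚ) ℚ.+-0-isCommutativeMonoid (↭⇒↭ₛ p)

sumℚ-++ : ∀ xs ys → sumℚ (xs ++ ys) ≡ sumℚ xs + sumℚ ys
sumℚ-++ []       ys = sym (ℚ.+-identityˡ (sumℚ ys))
sumℚ-++ (x ∷ xs) ys = trans (cong (x +_) (sumℚ-++ xs ys)) (sym (ℚ.+-assoc x (sumℚ xs) (sumℚ ys)))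

sumℚ-concat : ∀ xss → sumℚ (concat xss) ≡ sumℚ (map sumℚ xss)
sumℚ-concat []         = refl
sumℚ-concat (xs ∷ xss) = trans (sumℚ-++ xs (concat xss)) (cong (sumℚ xs +_) (sumℚ-concat xss))

module _ {A : Set} where

  sumℚ-map-*ʳ : ∀ (f : A → ℚ) k xs → sumℚ (map (λ x → f x * k) xs) ≡ sumℚ (map f xs) * k
  sumℚ-map-*ʳ f k []       = sym (ℚ.*-zeroˡ k)
  sumℚ-map-*ʳ f k (x ∷ xs) =
    trans (cong (f x * k +_) (sumℚ-map-*ʳ f k xs)) (sym (ℚ.*-distribʳ-+ k (f x) _))

  length-∷ʳ : ∀ (xs : List A) x → length (xs ∷ʳ x) ≡ suc (length xs)
  length-∷ʳ []       x = refl
  length-∷ʳ (y ∷ xs) x = cong suc (length-∷ʳ xs x)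

  sumℚ-map-concatMap : ∀ {B : Set} (f : B → ℚ) (g : A → List B) xs →
    sumℚ (map f (concatMap g xs)) ≡ sumℚ (map (λ x → sumℚ (map f (g x))) xs)
  sumℚ-map-concatMap f g xs = begin
    sumℚ (map f (concatMap g xs))                ≡⟨ cong sumℚ (map-concatMap f g xs) ⟩
    sumℚ (concat (map (map f ∘ g) xs))           ≡⟨ sumℚ-concat (map (map f ∘ g) xs) ⟩
    sumℚ (map sumℚ (map (map f ∘ g) xs))         ≡⟨ cong sumℚ (sym (map-∘ xs)) ⟩
    sumℚ (map (λ x → sumℚ (map f (g x))) xs)     ∎

  Unique-concatMap-∷ʳ : (f : A → List (List A)) → (∀ x → Unique (f x)) →
    ∀ {xs} → Unique xs → Unique (concatMap (λ x → map (_∷ʳ x) (f x)) xs)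
  Unique-concatMap-∷ʳ f f! xs! =
    Unique.concat⁺ (All.map⁺ (All.tabulate (λ {x} _ → Unique.map⁺ injective (f! x))))
                   (AllPairs.map⁺ (AllPairs.map disjoint xs!))
    where
    injective : ∀ {x c d} → c ∷ʳ x ≡ d ∷ʳ x → c ≡ d
    injective {c = c} {d} eq = proj₁ (∷ʳ-injective c d eq)
    disjoint : ∀ {x y} → x ≢ y → ∀ {v} → v ∈ map (_∷ʳ x) (f x) × v ∈ map (_∷ʳ y) (f y) → ⊥
    disjoint x≢y (v∈fx , v∈fy) with ∈-map⁻ (_∷ʳ _) v∈fx | ∈-map⁻ (_∷ʳ _) v∈fy
    ... | c , _ , refl | d , _ , eq = x≢y (proj₂ (∷ʳ-injective c d eq))

∈-insertions⁻ : ∀ x ys {c} → c ∈ insertions x ys → c ↭ x ∷ ys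
∈-insertions⁻ x []       (here refl) = ↭-refl
∈-insertions⁻ x (y ∷ ys) (here refl) = ↭-refl
∈-insertions⁻ x (y ∷ ys) (there c∈) with ∈-map⁻ (y ∷_) c∈
... | d , d∈ , refl = ↭-trans (prep y (∈-insertions⁻ x ys d∈)) (swap y x ↭-refl)

∈-insertions⁺ : ∀ x xs ys → xs ++ x ∷ ys ∈ insertions x (xs ++ ys)
∈-insertions⁺ x []       []       = here refl
∈-insertions⁺ x []       (y ∷ ys) = here refl
∈-insertions⁺ x (z ∷ xs) ys       = there (∈-map⁺ (z ∷_) (∈-insertions⁺ x xs ys))

∈-permutations⁻ : ∀ xs {ys} → ys ∈ permutations xs → ys ↭ xs
∈-permutations⁻ []       (here refl) = ↭-refl
∈-permutations⁻ (x ∷ xs) ys∈ with find (∈-concatMap⁻ (insertions x) {xs = permutations xs} ys∈)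
... | zs , zs∈ , ys∈′ = ↭-trans (∈-insertions⁻ x zs ys∈′) (prep x (∈-permutations⁻ xs zs∈))

∈-permutations⁺ : ∀ xs {ys} → ys ↭ xs → ys ∈ permutations xs
∈-permutations⁺ []       p with refl ← ↭-empty-inv p = here refl
∈-permutations⁺ (x ∷ xs) p with ∈-∃++ (∈-resp-↭ (↭-sym p) (here refl))
... | us , vs , refl =
  ∈-concatMap⁺ (insertions x)
    (lose (∈-permutations⁺ xs (drop-mid us [] p)) (∈-insertions⁺ x us vs))

∈-C⁻ : ∀ μ {c} → c ∈ C μ → c ↭ μ
∈-C⁻ μ = ∈-permutations⁻ μ ∘ Equivalence.from (deduplicate-∈⇔ (≡-dec ℕ._≟_))

∈-C⁺ : ∀ μ {c} → c ↭ μ → c ∈ C μ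
∈-C⁺ μ = Equivalence.to (deduplicate-∈⇔ (≡-dec ℕ._≟_)) ∘ ∈-permutations⁺ μ

C-unique : ∀ μ → Unique (C μ)
C-unique μ = Unique.deduplicate-! (≡-dec ℕ._≟_) (permutations μ)

∈-distinctParts⁻ : ∀ {i μ} → i ∈ distinctParts μ → i ∈ μ
∈-distinctParts⁻ = Equivalence.from (deduplicate-∈⇔ ℕ._≟_)

∈-distinctParts⁺ : ∀ {i μ} → i ∈ μ → i ∈ distinctParts μ
∈-distinctParts⁺ = Equivalence.to (deduplicate-∈⇔ ℕ._≟_)

removeOne-↭ : ∀ {i μ} → i ∈ μ → μ ↭ i ∷ removeOne i μ
removeOne-↭ {i} {x ∷ xs} i∈ with i ℕ.≟ x
... | yes refl = ↭-refl
removeOne-↭ {i} {x ∷ xs} (here refl) | no i≢x = ⊥-elim (i≢x refl)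
removeOne-↭ {i} {x ∷ xs} (there i∈) | no _ = ↭-trans (prep x (removeOne-↭ i∈)) (swap x i ↭-refl)

∷ʳ-↭-removeOne⁺ : ∀ {i μ c} → i ∈ μ → c ↭ removeOne i μ → c ∷ʳ i ↭ μ
∷ʳ-↭-removeOne⁺ {i} {c = c} i∈ p =
  ↭-trans (↭-sym (∷↭∷ʳ i c)) (↭-trans (prep i p) (↭-sym (removeOne-↭ i∈)))

∷ʳ-↭-removeOne⁻ : ∀ {i μ c} → c ∷ʳ i ↭ μ → i ∈ μ × c ↭ removeOne i μ
∷ʳ-↭-removeOne⁻ {i} {μ} {c} p = i∈ , subst (_↭ removeOne i μ) (++-identityʳ c) c↭
  where
  i∈ : i ∈ μ
  i∈ = ∈-resp-↭ p (∈-++⁺ʳ c (here refl))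
  c↭ : c ++ [] ↭ [] ++ removeOne i μ
  c↭ = drop-mid c [] (↭-trans p (removeOne-↭ i∈))

CEndingIn : List ℕ → ℕ → List (List ℕ)
CEndingIn μ i = map (_∷ʳ i) (C (removeOne i μ))

C-↭-concatMap-CEndingIn : ∀ {μ} → μ ≢ [] → C μ ↭ concatMap (CEndingIn μ) (distinctParts μ)
C-↭-concatMap-CEndingIn {μ} μ≢[] = ∼bag⇒↭ (unique∧set⇒bag (C-unique μ)
  (Unique-concatMap-∷ʳ (λ i → C (removeOne i μ)) (λ i → C-unique (removeOne i μ))
    (Unique.deduplicate-! ℕ._≟_ μ))
  (mk⇔ to from))
  where
  to : ∀ {c} → c ∈ C μ → c ∈ concatMap (CEndingIn μ) (distinctParts μ)
  to {c} c∈ with initLast c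
  ... | []       = ⊥-elim (μ≢[] (↭-empty-inv (↭-sym (∈-C⁻ μ c∈))))
  ... | d ∷ʳ′ i  with i∈ , d↭ ← ∷ʳ-↭-removeOne⁻ (∈-C⁻ μ c∈) =
    ∈-concatMap⁺ (CEndingIn μ) (lose (∈-distinctParts⁺ i∈) (∈-map⁺ (_∷ʳ i) (∈-C⁺ _ d↭)))
  from : ∀ {c} → c ∈ concatMap (CEndingIn μ) (distinctParts μ) → c ∈ C μ
  from c∈ with find (∈-concatMap⁻ (CEndingIn μ) c∈)
  ... | i , i∈ , c∈′ with ∈-map⁻ (_∷ʳ i) c∈′
  ... | d , d∈ , refl = ∈-C⁺ μ (∷ʳ-↭-removeOne⁺ (∈-distinctParts⁻ i∈) (∈-C⁻ _ d∈))

inv-cancelˡ : ∀ {x} → x ≢ 0ℚ → ∀ y → x * (y * inv x) ≡ y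
inv-cancelˡ {x} x≢0 y with x ℚ.≟ 0ℚ
... | yes x≡0 = ⊥-elim (x≢0 x≡0)
... | no  x≢0′ = begin
  x * (y * 1/ x)  ≡⟨ swap-left x y (1/ x) ⟩
  y * (x * 1/ x)  ≡⟨ cong (y *_) (ℚ.*-inverseʳ x) ⟩
  y * 1ℚ          ≡⟨ ℚ.*-identityʳ y ⟩
  y               ∎
  where
  instance _ = ≢-nonZero x≢0′
  swap-left : ∀ x y z → x * (y * z) ≡ y * (x * z)
  swap-left = solve 3 (λ x y z → x :* (y :* z) := y :* (x :* z)) refl

1-p≢0 : ∀ {p} → p ≢ 1ℚ → 1ℚ - p ≢ 0ℚ
1-p≢0 {p} p≢1 1-p≡0 = p≢1 (trans (p≡1-[1-p] p) (cong (1ℚ -_) 1-p≡0))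
  where
  p≡1-[1-p] : ∀ p → p ≡ 1ℚ - (1ℚ - p)
  p≡1-[1-p] = solve 1 (λ p → p := con 1ℚ :- (con 1ℚ :- p)) refl

pow-+ : ∀ x m n → pow x (m ℕ.+ n) ≡ pow x m * pow x n
pow-+ x ℕ.zero  n = sym (ℚ.*-identityˡ (pow x n))
pow-+ x (suc m) n = trans (cong (x *_) (pow-+ x m n)) (sym (ℚ.*-assoc x (pow x m) (pow x n)))

pow-* : ∀ x y n → pow (x * y) n ≡ pow x n * pow y n
pow-* x y ℕ.zero  = refl
pow-* x y (suc n) = trans (cong ((x * y) *_) (pow-* x y n)) (interchange x y (pow x n) (pow y n))
  where
  interchange : ∀ x y u v → (x * y) * (u * v) ≡ (x * u) * (y * v)
  interchange = solve 4 (λ x y u v → (x :* y) :* (u :* v) := (x :* u) :* (y :* v)) refl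

pow-shift : ∀ a q x l → pow a x * pow q (suc l ℕ.* x) ≡ pow (q * a) x * pow q (l ℕ.* x)
pow-shift a q x l = begin
  pow a x * pow q (x ℕ.+ l ℕ.* x)              ≡⟨ cong (pow a x *_) (pow-+ q x (l ℕ.* x)) ⟩
  pow a x * (pow q x * pow q (l ℕ.* x))        ≡⟨ regroup (pow a x) (pow q x) (pow q (l ℕ.* x)) ⟩
  (pow q x * pow a x) * pow q (l ℕ.* x)        ≡⟨ cong (_* pow q (l ℕ.* x)) (sym (pow-* q a x)) ⟩
  pow (q * a) x * pow q (l ℕ.* x)              ∎
  where
  regroup : ∀ u v w → u * (v * w) ≡ (v * u) * w
  regroup = solve 3 (λ u v w → u :* (v :* w) := (v :* u) :* w) refl

-- Appending a part lengthens every tail by one; the resulting extra q^{c_j}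
-- in each earlier factor is absorbed by replacing a with q a.
prodW-∷ʳ : ∀ a b q s cs i → prodW a b q s (cs ∷ʳ i)
  ≡ prodW (q * a) b q s cs * ((pow a i - pow b i) * inv (1ℚ - pow q (s ℕ.+ sum (cs ∷ʳ i))))
prodW-∷ʳ a b q s [] i = begin
  ((pow a i * 1ℚ - pow b i) * inv (1ℚ - pow q (s ℕ.+ i))) * 1ℚ
    ≡⟨ unit (pow a i) (pow b i) _ ⟩
  1ℚ * ((pow a i - pow b i) * inv (1ℚ - pow q (s ℕ.+ i)))
    ≡⟨ cong (λ n → 1ℚ * ((pow a i - pow b i) * inv (1ℚ - pow q (s ℕ.+ n)))) (sym (+-identityʳ i)) ⟩
  1ℚ * ((pow a i - pow b i) * inv (1ℚ - pow q (s ℕ.+ (i ℕ.+ 0)))) ∎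
  where
  unit : ∀ u v w → ((u * 1ℚ - v) * w) * 1ℚ ≡ 1ℚ * ((u - v) * w)
  unit = solve 3 (λ u v w → ((u :* con 1ℚ :- v) :* w) :* con 1ℚ := con 1ℚ :* ((u :- v) :* w)) refl
prodW-∷ʳ a b q s (x ∷ cs) i = begin
  ((pow a x * pow q (length (cs ∷ʳ i) ℕ.* x) - pow b x) * inv (1ℚ - pow q (s ℕ.+ x)))
    * prodW a b q (s ℕ.+ x) (cs ∷ʳ i)
    ≡⟨ cong₂ (λ u v → ((u - pow b x) * inv (1ℚ - pow q (s ℕ.+ x))) * v)
         shifted (prodW-∷ʳ a b q (s ℕ.+ x) cs i) ⟩
  F * (P * T (s ℕ.+ x ℕ.+ sum (cs ∷ʳ i)))    ≡⟨ cong (λ n → F * (P * T n)) (+-assoc s x _) ⟩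
  F * (P * T (s ℕ.+ (x ℕ.+ sum (cs ∷ʳ i))))  ≡⟨ sym (ℚ.*-assoc F P _) ⟩
  (F * P) * T (s ℕ.+ (x ℕ.+ sum (cs ∷ʳ i)))  ∎
  where
  F = (pow (q * a) x * pow q (length cs ℕ.* x) - pow b x) * inv (1ℚ - pow q (s ℕ.+ x))
  P = prodW (q * a) b q (s ℕ.+ x) cs
  T = λ n → (pow a i - pow b i) * inv (1ℚ - pow q n)
  shifted : pow a x * pow q (length (cs ∷ʳ i) ℕ.* x) ≡ pow (q * a) x * pow q (length cs ℕ.* x)
  shifted = trans (cong (λ l → pow a x * pow q (l ℕ.* x)) (length-∷ʳ cs i)) (pow-shift a q x (length cs))

sum-CEndingIn : ∀ μ a b q {i} → i ∈ μ →
  sumℚ (map (prodW a b q 0) (CEndingIn μ i))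
    ≡ W (removeOne i μ) (q * a) b q * ((pow a i - pow b i) * inv (1ℚ - pow q (sum μ)))
sum-CEndingIn μ a b q {i} i∈ = begin
  sumℚ (map (prodW a b q 0) (map (_∷ʳ i) (C μ′)))       ≡⟨ cong sumℚ (sym (map-∘ (C μ′))) ⟩
  sumℚ (map (prodW a b q 0 ∘ (_∷ʳ i)) (C μ′))           ≡⟨ cong sumℚ (map-cong-local (All.tabulate last-factor)) ⟩
  sumℚ (map (λ d → prodW (q * a) b q 0 d * L) (C μ′))   ≡⟨ sumℚ-map-*ʳ (prodW (q * a) b q 0) L (C μ′) ⟩
  W μ′ (q * a) b q * L                                  ∎
  where
  μ′ = removeOne i μ
  L = (pow a i - pow b i) * inv (1ℚ - pow q (sum μ))
  last-factor : ∀ {d} → d ∈ C μ′ → prodW a b q 0 (d ∷ʳ i) ≡ prodW (q * a) b q 0 d * L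
  last-factor {d} d∈ = trans (prodW-∷ʳ a b q 0 d i)
    (cong (λ n → prodW (q * a) b q 0 d * ((pow a i - pow b i) * inv (1ℚ - pow q n)))
          (sum-↭ (∷ʳ-↭-removeOne⁺ i∈ (∈-C⁻ μ′ d∈))))

-- No condition on q is needed: if q^{|μ|} = 1 both sides are 0, as inv 0 = 0.
W-by-last-part : ∀ μ → μ ≢ [] → ∀ a b q → W μ a b q
  ≡ sumℚ (map (λ i → (pow a i - pow b i) * W (removeOne i μ) (q * a) b q) (distinctParts μ))
    * inv (1ℚ - pow q (sum μ))
W-by-last-part μ μ≢[] a b q = begin
  sumℚ (map P (C μ))                                    ≡⟨ sumℚ-↭ (↭-map⁺ P (C-↭-concatMap-CEndingIn μ≢[])) ⟩
  sumℚ (map P (concatMap (CEndingIn μ) ds))             ≡⟨ sumℚ-map-concatMap P (CEndingIn μ) ds ⟩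
  sumℚ (map (λ i → sumℚ (map P (CEndingIn μ i))) ds)    ≡⟨ cong sumℚ (map-cong-local (All.tabulate regrouped)) ⟩
  sumℚ (map (λ i → H i * L) ds)                         ≡⟨ sumℚ-map-*ʳ H L ds ⟩
  sumℚ (map H ds) * L                                   ∎
  where
  P = prodW a b q 0
  ds = distinctParts μ
  L = inv (1ℚ - pow q (sum μ))
  H : ℕ → ℚ
  H i = (pow a i - pow b i) * W (removeOne i μ) (q * a) b q
  reassoc : ∀ w d l → w * (d * l) ≡ (d * w) * l
  reassoc = solve 3 (λ w d l → w :* (d :* l) := (d :* w) :* l) refl
  regrouped : ∀ {i} → i ∈ ds → sumℚ (map P (CEndingIn μ i)) ≡ H i * L
  regrouped {i} i∈ = trans (sum-CEndingIn μ a b q (∈-distinctParts⁻ i∈))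
                           (reassoc (W (removeOne i μ) (q * a) b q) (pow a i - pow b i) L)

head-positive : ∀ {x xs} → IsPartition (x ∷ xs) → 1 ≤ x
head-positive (one 1≤x)       = 1≤x
head-positive (cons y≤x y∷ys) = ≤-trans (head-positive y∷ys) y≤x

sum-positive : ∀ {μ} → IsPartition μ → μ ≢ [] → 1 ≤ sum μ
sum-positive {[]}     _ μ≢[] = ⊥-elim (μ≢[] refl)
sum-positive {x ∷ xs} μ _    = ≤-trans (head-positive μ) (m≤m+n x (sum xs))

proposition4 : (μ : List ℕ) → IsPartition μ → μ ≢ [] →
    (a b q : ℚ) → (∀ k → 1 ≤ k → k ≤ sum μ → pow q k ≢ 1ℚ) →
    (1ℚ - pow q (sum μ)) * W μ a b q
      ≡ sumℚ (map (λ i → (pow a i - pow b i) * W (removeOne i μ) (q * a) b q) (distinctParts μ))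
proposition4 μ μ-partition μ≢[] a b q q^k≢1 =
  trans (cong ((1ℚ - pow q (sum μ)) *_) (W-by-last-part μ μ≢[] a b q))
        (inv-cancelˡ (1-p≢0 (q^k≢1 (sum μ) (sum-positive μ-partition μ≢[]) ≤-refl)) _)
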